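{- Let $F$ be a finite forest with an isolated vertex $v_0$. Then $o(F)=\mathcal{A}$ if and only if $F\setminus\{v_0\}$ has a perfect matching.
   Context: Maker-Maker domination game on a finite simple graph $G$: Alice and Bob alternately claim previously unclaimed vertices, Alice first; the first player whose claimed vertices form a dominating set of $G$ wins; if all vertices are claimed and nobody dominates, it is a draw. $o(G)=\mathcal{A}$ if Alice has a winning strategy and $o(G)=\mathcal{D}$ otherwise. -}

module Defs where

open import Data.Nat using (ℕ; suc)
open import Data.Bool using (Bool; true; false)
open import Data.Fin using (Fin; zero; suc; inject₁; fromℕ)
open import Data.Fin.Subset using (Subset; _∈_; _∉_; _∪_; ⁅_⁆; ⊥)
open import Data.Product using (Σ; ∃; ∃-syntax; _×_; _,_)
open import Data.Sum using (_⊎_)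
open import Relation.Nullary using (¬_)
open import Relation.Binary.PropositionalEquality using (_≡_)
open import Function.Definitions using (Injective)

record Graph (n : ℕ) : Set where
  field
    adj    : Fin n → Fin n → Bool
    sym    : ∀ u v → adj u v ≡ adj v u
    irrefl : ∀ v → adj v v ≡ false
open Graph public

Adj : ∀ {n} → Graph n → Fin n → Fin n → Set
Adj G u v = adj G u v ≡ true

IsCycle : ∀ {n} (G : Graph n) (k : ℕ) → (Fin (suc (suc (suc k))) → Fin n) → Set
IsCycle G k c =
  Injective _≡_ _≡_ c
  × (∀ (i : Fin (suc (suc k))) → Adj G (c (inject₁ i)) (c (suc i)))
  × Adj G (c (fromℕ (suc (suc k)))) (c zero)

Forest : ∀ {n} → Graph n → Set
Forest G = ∀ k c → ¬ IsCycle G k c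

Isolated : ∀ {n} → Graph n → Fin n → Set
Isolated G v = ∀ u → adj G v u ≡ false

record PerfectMatchingMinus {n} (G : Graph n) (v₀ : Fin n) : Set where
  field
    M       : Fin n → Fin n → Bool
    M-sym   : ∀ u v → M u v ≡ M v u
    M-edge  : ∀ u v → M u v ≡ true → Adj G u v
    M-avoid : ∀ u → M v₀ u ≡ false
    M-cover : ∀ v → ¬ (v ≡ v₀) →
              Σ (Fin n) λ u → (M v u ≡ true) × (∀ w → M v w ≡ true → w ≡ u)

Dominates : ∀ {n} → Graph n → Subset n → Set
Dominates G D = ∀ v → v ∈ D ⊎ (∃[ u ] (u ∈ D × Adj G u v))

Unclaimed : ∀ {n} → Subset n → Subset n → Fin n → Set
Unclaimed A B v = v ∉ A × v ∉ B

-- AliceWins G A B : in the Maker-Maker domination game on G, at the position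
-- where Alice has claimed A, Bob has claimed B (neither dominating) and it is
-- Alice's turn, Alice has a winning strategy. Alice picks an unclaimed v;
-- either her set now dominates (she wins), or the game continues: some
-- vertex is still unclaimed (otherwise it is a draw), and for every
-- unclaimed reply u of Bob, Bob's set does not dominate and Alice again
-- has a winning strategy.
data AliceWins {n} (G : Graph n) (A B : Subset n) : Set where
  win  : (v : Fin n) → Unclaimed A B v → Dominates G (⁅ v ⁆ ∪ A) →
         AliceWins G A B
  play : (v : Fin n) → Unclaimed A B v → ¬ Dominates G (⁅ v ⁆ ∪ A) →
         (∃[ u ] Unclaimed (⁅ v ⁆ ∪ A) B u) →
         (∀ u → Unclaimed (⁅ v ⁆ ∪ A) B u →
           (¬ Dominates G (⁅ u ⁆ ∪ B)) × AliceWins G (⁅ v ⁆ ∪ A) (⁅ u ⁆ ∪ B)) →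
         AliceWins G A B

OutcomeA : ∀ {n} → Graph n → Set
OutcomeA G = AliceWins G ⊥ ⊥

{-# OPTIONS --safe #-}
module Submission where

-- If F ∖ v₀ has a perfect matching, Alice claims v₀ first and then answers every claim of Bob
-- by the mate of the claimed vertex. Bob never dominates, since he never gets the isolated v₀,
-- and once the board is full each vertex of Bob is dominated by its mate, held by Alice.
--
-- Conversely, suppose Alice wins. Her first move must be v₀: otherwise Bob takes it and v₀ can
-- never be dominated by her. From then on Bob exploits the forest structure: every nonempty set
-- of vertices of a forest contains a vertex with at most one neighbour inside it (else a
-- non-backtracking walk would close a cycle). If such a vertex x of the unmatched part has no
-- neighbour there, Bob claims x and Alice can never dominate it; if it is a leaf ℓ with
-- neighbour s, Bob claims s and Alice is forced to answer ℓ. Repeating this on the rest pairs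
-- off all vertices other than v₀ along edges, i.e. yields a perfect matching of F ∖ v₀.

open import Defs
open import Data.Bool using (Bool; true)
import Data.Bool.Properties as Bool
open import Data.Empty using (⊥-elim)
open import Data.Fin using (Fin; zero; suc; _≟_; toℕ; inject₁; fromℕ)
open import Data.Fin.Properties using (any?; all?; pigeonhole; toℕ-injective; toℕ<n; toℕ-inject₁; toℕ-fromℕ)
open import Data.Fin.Subset using (Subset; _∈_; _∉_; _∪_; _-_; _⊂_; _⊃_; ⁅_⁆; ⊤; ⊥; Empty)
open import Data.Fin.Subset.Induction using (⊂-wellFounded; ⊃-wellFounded)
open import Data.Fin.Subset.Properties
  using (∉⊥; nonempty?; ⊆-⊂-trans; x∈p⇒p-x⊂p; x∈p∪q⁻; x∈p∪q⁺; x∈⁅x⁆; x∈⁅y⁆⇒x≡y; _∈?_; ∈⊤; q⊆p∪q; p─q⊆p; x∈p∧x≢y⇒x∈p-y)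
open import Data.Nat using (ℕ; zero; suc; _+_; _<_; s≤s)
open import Data.Nat.Induction using (<-wellFounded)
import Data.Nat.Properties as ℕ
open import Data.Nat.Properties using (anyUpTo?)
open import Induction.WellFounded using (Acc; acc)
import Relation.Unary as U
open import Relation.Binary.Definitions using (tri<; tri≈; tri>)
open import Data.Product using (∃; ∃₂; ∃-syntax; _×_; _,_; proj₁; proj₂)
open import Data.Sum using (_⊎_; inj₁; inj₂)
open import Data.Vec using (_∷_; there)
open import Function.Base using (id; _∘_)
open import Function.Bundles using (_⇔_; mk⇔)
open import Relation.Nullary using (¬_; Dec; yes; no; does; contradiction)
open import Relation.Nullary.Decidable using (_×-dec_; _⊎-dec_; ¬?; decidable-stable; dec-true; dec-false; does-⇔)
open import Relation.Binary.PropositionalEquality using (_≡_; _≢_; ≢-sym; refl; trans; cong; subst; subst₂)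
import Relation.Binary.PropositionalEquality as ≡

private
  variable
    n : ℕ

does≡true⇒ : ∀ {A : Set} (a? : Dec A) → does a? ≡ true → A
does≡true⇒ (yes a) _  = a
does≡true⇒ (no _)  ()

module _ {x y : Fin n} {p : Subset n} where

  x∈⁅y⁆∪p⁻ : x ∈ ⁅ y ⁆ ∪ p → x ≡ y ⊎ x ∈ p
  x∈⁅y⁆∪p⁻ x∈ with x∈p∪q⁻ ⁅ y ⁆ p x∈
  ... | inj₁ x∈⁅y⁆ = inj₁ (x∈⁅y⁆⇒x≡y y x∈⁅y⁆)
  ... | inj₂ x∈p   = inj₂ x∈p

  x∈p⇒x∈⁅y⁆∪p : x ∈ p → x ∈ ⁅ y ⁆ ∪ p
  x∈p⇒x∈⁅y⁆∪p x∈p = x∈p∪q⁺ (inj₂ x∈p)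

  x≢y∧x∉p⇒x∉⁅y⁆∪p : x ≢ y → x ∉ p → x ∉ ⁅ y ⁆ ∪ p
  x≢y∧x∉p⇒x∉⁅y⁆∪p x≢y x∉p x∈ with x∈⁅y⁆∪p⁻ x∈
  ... | inj₁ x≡y = x≢y x≡y
  ... | inj₂ x∈p = x∉p x∈p

  x∉⁅y⁆∪p⁻ : x ∉ ⁅ y ⁆ ∪ p → x ≢ y × x ∉ p
  x∉⁅y⁆∪p⁻ x∉ = (λ { refl → x∉ (x∈p∪q⁺ (inj₁ (x∈⁅x⁆ x))) }) , (λ x∈p → x∉ (x∈p⇒x∈⁅y⁆∪p x∈p))

x∈⁅x⁆∪p : ∀ {x : Fin n} {p} → x ∈ ⁅ x ⁆ ∪ p
x∈⁅x⁆∪p {x = x} = x∈p∪q⁺ (inj₁ (x∈⁅x⁆ x))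

x∉p⇒p⊂⁅x⁆∪p : ∀ {x : Fin n} {p} → x ∉ p → p ⊂ ⁅ x ⁆ ∪ p
x∉p⇒p⊂⁅x⁆∪p {x = x} {p} x∉p = q⊆p∪q ⁅ x ⁆ p , x , x∈⁅x⁆∪p , x∉p

x∈p-y⁻ : ∀ {x y : Fin n} {p} → x ∈ p - y → x ∈ p × x ≢ y
x∈p-y⁻ {y = y} {p} x∈ = p─q⊆p p ⁅ y ⁆ x∈ , λ { refl → x∉p─⁅x⁆ p x∈ }
  where
  x∉p─⁅x⁆ : ∀ {n} {x : Fin n} (p : Subset n) → x ∉ p - x
  x∉p─⁅x⁆ {x = zero}  (_ ∷ p) ()
  x∉p─⁅x⁆ {x = suc x} (_ ∷ p) (there x∈) = x∉p─⁅x⁆ p x∈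

x∈p-y-z⁻ : ∀ {x y z : Fin n} {p} → x ∈ p - y - z → x ∈ p × x ≢ y × x ≢ z
x∈p-y-z⁻ x∈ = let x∈p-y , x≢z = x∈p-y⁻ x∈ ; x∈p , x≢y = x∈p-y⁻ x∈p-y in x∈p , x≢y , x≢z

x∈p-y-z⁺ : ∀ {x y z : Fin n} {p} → x ∈ p → x ≢ y → x ≢ z → x ∈ p - y - z
x∈p-y-z⁺ x∈p x≢y x≢z = x∈p∧x≢y⇒x∈p-y (x∈p∧x≢y⇒x∈p-y x∈p x≢y) x≢z

x∈⊤-y⇒x≢y : ∀ {x y : Fin n} → x ∈ ⊤ - y → x ≢ y
x∈⊤-y⇒x≢y x∈ = proj₂ (x∈p-y⁻ x∈)

x≢y⇒x∈⊤-y : ∀ {x y : Fin n} → x ≢ y → x ∈ ⊤ - y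
x≢y⇒x∈⊤-y = x∈p∧x≢y⇒x∈p-y ∈⊤

module _ (G : Graph n) where

  Adj-sym : ∀ {u v} → Adj G u v → Adj G v u
  Adj-sym {u} {v} u~v = trans (sym G v u) u~v

  Adj-irrefl : ∀ {v} → ¬ Adj G v v
  Adj-irrefl {v} v~v with trans (≡.sym v~v) (irrefl G v)
  ... | ()

  Isolated⇒¬Adj : ∀ {v} → Isolated G v → ∀ {u} → ¬ Adj G u v
  Isolated⇒¬Adj {v} iso {u} u~v with trans (≡.sym (Adj-sym u~v)) (iso u)
  ... | ()

  Isolated∉⇒¬Dominates : ∀ {v D} → Isolated G v → v ∉ D → ¬ Dominates G D
  Isolated∉⇒¬Dominates iso v∉D dom with dom _
  ... | inj₁ v∈D           = v∉D v∈D
  ... | inj₂ (_ , _ , u~v) = Isolated⇒¬Adj iso u~v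

record PerfectMatching (G : Graph n) (X : Subset n) : Set where
  field
    mate       : Fin n → Fin n
    mate-∈     : ∀ {x} → x ∈ X → mate x ∈ X
    mate-invol : ∀ {x} → x ∈ X → mate (mate x) ≡ x
    mate-adj   : ∀ {x} → x ∈ X → Adj G x (mate x)

module _ {G : Graph n} {v₀ : Fin n} where

  fromPerfectMatchingMinus : PerfectMatchingMinus G v₀ → PerfectMatching G (⊤ - v₀)
  fromPerfectMatchingMinus P = record
    { mate       = mate
    ; mate-∈     = λ x∈ → x≢y⇒x∈⊤-y (mate≢v₀ (x∈⊤-y⇒x≢y x∈))
    ; mate-invol = λ x∈ → let x≢v₀ = x∈⊤-y⇒x≢y x∈ in
        M-unique (mate≢v₀ x≢v₀) (M-mate (mate≢v₀ x≢v₀)) (trans (M-sym _ _) (M-mate x≢v₀))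
    ; mate-adj   = λ x∈ → M-edge _ _ (M-mate (x∈⊤-y⇒x≢y x∈))
    }
    where
    open PerfectMatchingMinus P

    mate : Fin n → Fin n
    mate x with x ≟ v₀
    ... | yes _   = v₀
    ... | no x≢v₀ = proj₁ (M-cover x x≢v₀)

    M-mate : ∀ {x} → x ≢ v₀ → M x (mate x) ≡ true
    M-mate {x} x≢v₀ with x ≟ v₀
    ... | yes x≡v₀ = contradiction x≡v₀ x≢v₀
    ... | no x≢v₀  = proj₁ (proj₂ (M-cover x x≢v₀))

    ¬M-v₀ : ∀ {x} → M x v₀ ≢ true
    ¬M-v₀ {x} xMv₀ with trans (≡.sym (M-avoid x)) (trans (M-sym v₀ x) xMv₀)
    ... | ()

    mate≢v₀ : ∀ {x} → x ≢ v₀ → mate x ≢ v₀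
    mate≢v₀ {x} x≢v₀ mate≡v₀ = ¬M-v₀ (subst (λ y → M x y ≡ true) mate≡v₀ (M-mate x≢v₀))

    M-unique : ∀ {x y z} → x ≢ v₀ → M x y ≡ true → M x z ≡ true → y ≡ z
    M-unique {x} x≢v₀ xMy xMz =
      let _ , _ , unique = M-cover x x≢v₀ in trans (unique _ xMy) (≡.sym (unique _ xMz))

  toPerfectMatchingMinus : PerfectMatching G (⊤ - v₀) → PerfectMatchingMinus G v₀
  toPerfectMatchingMinus P = record
    { M       = M
    ; M-sym   = λ x y → does-⇔ (mk⇔ matched-sym matched-sym) (matched? x y) (matched? y x)
    ; M-edge  = λ x y xMy → let x∈ , mate≡y = matched xMy in subst (Adj G x) mate≡y (mate-adj x∈)
    ; M-avoid = λ y → dec-false (matched? v₀ y) (λ (v₀∈ , _) → x∈⊤-y⇒x≢y v₀∈ refl)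
    ; M-cover = λ x x≢v₀ →
        mate x , dec-true (matched? x (mate x)) (x≢y⇒x∈⊤-y x≢v₀ , refl) , λ y xMy → ≡.sym (proj₂ (matched xMy))
    }
    where
    open PerfectMatching P

    Matched : Fin n → Fin n → Set
    Matched x y = x ∈ ⊤ - v₀ × mate x ≡ y

    matched? : ∀ x y → Dec (Matched x y)
    matched? x y = (x ∈? ⊤ - v₀) ×-dec (mate x ≟ y)

    M : Fin n → Fin n → Bool
    M x y = does (matched? x y)

    matched : ∀ {x y} → M x y ≡ true → Matched x y
    matched {x} {y} = does≡true⇒ (matched? x y)

    matched-sym : ∀ {x y} → Matched x y → Matched y x
    matched-sym (x∈ , refl) = mate-∈ x∈ , mate-invol x∈

module _ {G : Graph n} where

  emptyPerfectMatching : ∀ {X} → Empty X → PerfectMatching G X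
  emptyPerfectMatching X-empty = record
    { mate       = id
    ; mate-∈     = λ x∈ → ⊥-elim (X-empty (_ , x∈))
    ; mate-invol = λ x∈ → ⊥-elim (X-empty (_ , x∈))
    ; mate-adj   = λ x∈ → ⊥-elim (X-empty (_ , x∈))
    }

  addEdge : ∀ {X ℓ s} → ℓ ∈ X → s ∈ X → Adj G ℓ s →
            PerfectMatching G (X - ℓ - s) → PerfectMatching G X
  addEdge {X} {ℓ} {s} ℓ∈ s∈ ℓ~s P = record
    { mate = mate′ ; mate-∈ = mate′-∈ ; mate-invol = mate′-invol ; mate-adj = mate′-adj }
    where
    open PerfectMatching P

    ℓ≢s : ℓ ≢ s
    ℓ≢s refl = Adj-irrefl G ℓ~s

    split : ∀ {x} → x ∈ X → x ≡ ℓ ⊎ x ≡ s ⊎ x ∈ X - ℓ - s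
    split {x} x∈ with x ≟ ℓ | x ≟ s
    ... | yes x≡ℓ | _       = inj₁ x≡ℓ
    ... | no _    | yes x≡s = inj₂ (inj₁ x≡s)
    ... | no x≢ℓ  | no x≢s  = inj₂ (inj₂ (x∈p-y-z⁺ x∈ x≢ℓ x≢s))

    mate′ : Fin n → Fin n
    mate′ x with x ≟ ℓ | x ≟ s
    ... | yes _ | _     = s
    ... | no _  | yes _ = ℓ
    ... | no _  | no _  = mate x

    mate′-ℓ : mate′ ℓ ≡ s
    mate′-ℓ with ℓ ≟ ℓ
    ... | yes _   = refl
    ... | no ℓ≢ℓ  = contradiction refl ℓ≢ℓ

    mate′-s : mate′ s ≡ ℓ
    mate′-s with s ≟ ℓ | s ≟ s
    ... | yes s≡ℓ | _      = contradiction (≡.sym s≡ℓ) ℓ≢s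
    ... | no _    | yes _  = refl
    ... | no _    | no s≢s = contradiction refl s≢s

    mate′-rest : ∀ {x} → x ∈ X - ℓ - s → mate′ x ≡ mate x
    mate′-rest {x} x∈ with x∈p-y-z⁻ x∈ | x ≟ ℓ | x ≟ s
    ... | _ , x≢ℓ , _   | yes x≡ℓ | _       = contradiction x≡ℓ x≢ℓ
    ... | _ , _ , x≢s   | no _    | yes x≡s = contradiction x≡s x≢s
    ... | _             | no _    | no _    = refl

    mate′-∈ : ∀ {x} → x ∈ X → mate′ x ∈ X
    mate′-∈ x∈ with split x∈
    ... | inj₁ refl        = subst (_∈ X) (≡.sym mate′-ℓ) s∈
    ... | inj₂ (inj₁ refl) = subst (_∈ X) (≡.sym mate′-s) ℓ∈
    ... | inj₂ (inj₂ x∈′)  = subst (_∈ X) (≡.sym (mate′-rest x∈′)) (proj₁ (x∈p-y-z⁻ (mate-∈ x∈′)))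

    mate′-invol : ∀ {x} → x ∈ X → mate′ (mate′ x) ≡ x
    mate′-invol {x} x∈ with split x∈
    ... | inj₁ refl        = trans (cong mate′ mate′-ℓ) mate′-s
    ... | inj₂ (inj₁ refl) = trans (cong mate′ mate′-s) mate′-ℓ
    ... | inj₂ (inj₂ x∈′)  = begin
      mate′ (mate′ x) ≡⟨ cong mate′ (mate′-rest x∈′) ⟩
      mate′ (mate x)  ≡⟨ mate′-rest (mate-∈ x∈′) ⟩
      mate (mate x)   ≡⟨ mate-invol x∈′ ⟩
      x               ∎
      where open ≡.≡-Reasoning

    mate′-adj : ∀ {x} → x ∈ X → Adj G x (mate′ x)
    mate′-adj x∈ with split x∈
    ... | inj₁ refl        = subst (Adj G ℓ) (≡.sym mate′-ℓ) ℓ~s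
    ... | inj₂ (inj₁ refl) = subst (Adj G s) (≡.sym mate′-s) (Adj-sym G ℓ~s)
    ... | inj₂ (inj₂ x∈′)  = subst (Adj G _) (≡.sym (mate′-rest x∈′)) (mate-adj x∈′)

least-witness : ∀ {P : ℕ → Set} → U.Decidable P → ∃ P →
                ∃[ m ] P m × (∀ {k} → k < m → ¬ P k)
least-witness {P = P} P? (j , Pj) = go (<-wellFounded j) Pj
  where
  go : ∀ {j} → Acc _<_ j → P j → ∃[ m ] P m × (∀ {k} → k < m → ¬ P k)
  go {j} (acc rs) Pj with anyUpTo? P? j
  ... | yes (k , k<j , Pk) = go (rs k<j) Pk
  ... | no ∄k              = j , Pj , λ k<j Pk → ∄k (_ , k<j , Pk)

firstRepetition : (f : ℕ → Fin n) →
                  ∃₂ λ i j → i < j × f i ≡ f j × (∀ {a b} → a < j → b < j → f a ≡ f b → a ≡ b)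
firstRepetition {n} f =
  let j , (i , i<j , fi≡fj) , least = least-witness repeats? pigeonhole-repeat
  in  i , j , i<j , fi≡fj , injective least
  where
  Repeats : ℕ → Set
  Repeats j = ∃[ i ] i < j × f i ≡ f j

  repeats? : U.Decidable Repeats
  repeats? j = anyUpTo? (λ i → f i ≟ f j) j

  pigeonhole-repeat : ∃ Repeats
  pigeonhole-repeat = let i , j , i<j , fi≡fj = pigeonhole (ℕ.n<1+n n) (f ∘ toℕ) in toℕ j , toℕ i , i<j , fi≡fj

  injective : ∀ {j} → (∀ {k} → k < j → ¬ Repeats k) →
              ∀ {a b} → a < j → b < j → f a ≡ f b → a ≡ b
  injective {j} least {a} {b} a<j b<j fa≡fb with ℕ.<-cmp a b
  ... | tri< a<b _ _ = contradiction (a , a<b , fa≡fb) (least b<j)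
  ... | tri≈ _ a≡b _ = a≡b
  ... | tri> _ _ b<a = contradiction (b , b<a , ≡.sym fa≡fb) (least a<j)

module _ (G : Graph n) where

  record NonBacktrackingWalk : Set where
    field
      vertex       : ℕ → Fin n
      step         : ∀ t → Adj G (vertex t) (vertex (suc t))
      no-backtrack : ∀ t → vertex (suc (suc t)) ≢ vertex t

  module _ (W : NonBacktrackingWalk) where
    open NonBacktrackingWalk W renaming (vertex to w)

    closedWalk⇒cycle : ∀ i d → w (suc i + d) ≡ w i →
                       (∀ {a b} → a < suc i + d → b < suc i + d → w a ≡ w b → a ≡ b) →
                       ∃₂ (IsCycle G)
    closedWalk⇒cycle i zero e _ =
      contradiction (subst (Adj G (w i)) (trans (cong w (≡.sym (ℕ.+-identityʳ (suc i)))) e) (step i))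
                    (Adj-irrefl G)
    closedWalk⇒cycle i (suc zero) e _ =
      contradiction (trans (cong (w ∘ suc) (ℕ.+-comm 1 i)) e) (no-backtrack i)
    closedWalk⇒cycle i (suc (suc k)) e injective = k , c , c-injective , c-step , c-closes
      where
      c : Fin (suc (suc (suc k))) → Fin n
      c m = w (i + toℕ m)

      inRange : ∀ m → i + toℕ m < suc i + suc (suc k)
      inRange m = s≤s (ℕ.+-monoʳ-≤ i (ℕ.≤-pred (toℕ<n m)))

      c-injective : ∀ {m m′} → c m ≡ c m′ → m ≡ m′
      c-injective {m} {m′} cm≡cm′ =
        toℕ-injective (ℕ.+-cancelˡ-≡ i _ _ (injective (inRange m) (inRange m′) cm≡cm′))

      c-step : ∀ m → Adj G (c (inject₁ m)) (c (suc m))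
      c-step m = subst₂ (Adj G) (cong (λ t → w (i + t)) (≡.sym (toℕ-inject₁ m)))
                                (cong w (≡.sym (ℕ.+-suc i (toℕ m))))
                                (step (i + toℕ m))

      c-closes : Adj G (c (fromℕ (suc (suc k)))) (c zero)
      c-closes = subst₂ (Adj G) (cong (λ t → w (i + t)) (≡.sym (toℕ-fromℕ (suc (suc k)))))
                                (trans e (cong w (≡.sym (ℕ.+-identityʳ i))))
                                (step (i + suc (suc k)))

    nonBacktrackingWalk⇒cycle : ∃₂ (IsCycle G)
    nonBacktrackingWalk⇒cycle with firstRepetition w
    ... | i , j , i<j , wi≡wj , injective with ℕ.m≤n⇒∃[o]m+o≡n i<j
    ... | d , refl = closedWalk⇒cycle i d (≡.sym wi≡wj) injective

  AtMostOneNeighbourIn : Subset n → Fin n → Set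
  AtMostOneNeighbourIn X x = ∀ {y z} → y ∈ X → z ∈ X → Adj G x y → Adj G x z → y ≡ z

  -- Equivalently, x has at least two neighbours in X.
  BranchingIn : Subset n → Fin n → Set
  BranchingIn X x = ∀ p → ∃[ y ] y ∈ X × Adj G x y × y ≢ p

  atMostOneNeighbour⊎branching : ∀ X x → AtMostOneNeighbourIn X x ⊎ BranchingIn X x
  atMostOneNeighbour⊎branching X x with any? (λ y → y ∈? X ×-dec adj G x y Bool.≟ true)
  ... | no ∄y = inj₁ λ y∈ _ x~y _ → contradiction (_ , y∈ , x~y) ∄y
  ... | yes (y , y∈ , x~y) with any? (λ z → z ∈? X ×-dec adj G x z Bool.≟ true ×-dec ¬? (z ≟ y))
  ...   | yes (z , z∈ , x~z , z≢y) = inj₂ other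
    where
    other : BranchingIn X x
    other p with y ≟ p
    ... | yes refl = z , z∈ , x~z , z≢y
    ... | no y≢p   = y , y∈ , x~y , y≢p
  ...   | no ∄z = inj₁ λ y′∈ z′∈ x~y′ x~z′ → trans (onlyY y′∈ x~y′) (≡.sym (onlyY z′∈ x~z′))
    where
    onlyY : ∀ {w} → w ∈ X → Adj G x w → w ≡ y
    onlyY w∈ x~w = decidable-stable (_ ≟ y) (λ w≢y → ∄z (_ , w∈ , x~w , w≢y))

  atMostOneNeighbourIn? : ∀ X → U.Decidable (AtMostOneNeighbourIn X)
  atMostOneNeighbourIn? X x with atMostOneNeighbour⊎branching X x
  ... | inj₁ atMostOne = yes atMostOne
  ... | inj₂ branching = no λ atMostOne →
    let y , y∈ , x~y , _ = branching x ; z , z∈ , x~z , z≢y = branching y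
    in  z≢y (atMostOne z∈ y∈ x~z x~y)

  module _ {X : Subset n} (branching : ∀ {x} → x ∈ X → BranchingIn X x) where

    record Arc : Set where
      field
        tail head : Fin n
        head∈X    : head ∈ X
        tail~head : Adj G tail head
    open Arc

    next : Arc → Arc
    next a = let y , y∈X , head~y , _ = branching (head∈X a) (tail a)
             in  record { tail = head a ; head = y ; head∈X = y∈X ; tail~head = head~y }

    arcs : Arc → ℕ → Arc
    arcs a zero    = a
    arcs a (suc t) = next (arcs a t)

    branchingWalk : Arc → NonBacktrackingWalk
    branchingWalk a = record
      { vertex       = tail ∘ arcs a
      ; step         = tail~head ∘ arcs a
      ; no-backtrack = λ t → let b = arcs a t in proj₂ (proj₂ (proj₂ (branching (head∈X b) (tail b))))
      }

  forest⇒atMostOneNeighbourIn : Forest G → ∀ {X x₀} → x₀ ∈ X →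
                                 ∃[ x ] x ∈ X × AtMostOneNeighbourIn X x
  forest⇒atMostOneNeighbourIn forest {X} {x₀} x₀∈X
    with any? (λ x → x ∈? X ×-dec atMostOneNeighbourIn? X x)
  ... | yes found = found
  ... | no ∄x     = let k , c , isCycle = nonBacktrackingWalk⇒cycle (branchingWalk branching start)
                    in  contradiction isCycle (forest k c)
    where
    branching : ∀ {x} → x ∈ X → BranchingIn X x
    branching {x} x∈ with atMostOneNeighbour⊎branching X x
    ... | inj₁ atMostOne = contradiction (x , x∈ , λ {y} {z} → atMostOne) ∄x
    ... | inj₂ br        = br

    start : Arc branching
    start = let y , y∈X , x₀~y , _ = branching x₀∈X x₀
            in  record { tail = x₀ ; head = y ; head∈X = y∈X ; tail~head = x₀~y }

module _ (G : Graph n) where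

  AliceWinsBobToMove : Subset n → Subset n → Set
  AliceWinsBobToMove A B = ∀ u → Unclaimed A B u → AliceWins G A (⁅ u ⁆ ∪ B)

  AliceWinsAfterMove : Subset n → Subset n → Set
  AliceWinsAfterMove A B = Dominates G A ⊎ AliceWinsBobToMove A B

  aliceMove : ∀ {A B} → AliceWins G A B → ∃[ v ] Unclaimed A B v × AliceWinsAfterMove (⁅ v ⁆ ∪ A) B
  aliceMove (win v v-free dom)          = v , v-free , inj₁ dom
  aliceMove (play v v-free _ _ respond) = v , v-free , inj₂ (λ u u-free → proj₂ (respond u u-free))

  Undominated : Subset n → Fin n → Set
  Undominated A x = x ∉ A × (∀ {y} → Adj G y x → y ∉ A)

  undominated⇒¬Dominates : ∀ {A x} → Undominated A x → ¬ Dominates G A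
  undominated⇒¬Dominates (x∉A , nbrs∉A) dom with dom _
  ... | inj₁ x∈A            = x∉A x∈A
  ... | inj₂ (_ , y∈A , y~x) = nbrs∉A y~x y∈A

  -- Alice can now dominate x only by claiming x herself.
  Exposed : Subset n → Subset n → Fin n → Set
  Exposed A B x = (∀ {y} → Adj G y x → y ∈ B) × Undominated A x

  exposed-∪ˡ : ∀ {A B x v} → v ∉ B → x ≢ v → Exposed A B x → Exposed (⁅ v ⁆ ∪ A) B x
  exposed-∪ˡ v∉B x≢v (nbrs∈B , x∉A , nbrs∉A) =
    nbrs∈B , x≢y∧x∉p⇒x∉⁅y⁆∪p x≢v x∉A ,
    λ y~x → x≢y∧x∉p⇒x∉⁅y⁆∪p (λ { refl → v∉B (nbrs∈B y~x) }) (nbrs∉A y~x)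

  exposed-∪ʳ : ∀ {A B x u} → Exposed A B x → Exposed A (⁅ u ⁆ ∪ B) x
  exposed-∪ʳ (nbrs∈B , undominated) = x∈p⇒x∈⁅y⁆∪p ∘ nbrs∈B , undominated

  isolated⇒exposed : ∀ {A B v} → Isolated G v → v ∉ A → Exposed A B v
  isolated⇒exposed v-isolated v∉A =
    (λ y~v → contradiction y~v (Isolated⇒¬Adj G v-isolated)) ,
    v∉A , (λ y~v → contradiction y~v (Isolated⇒¬Adj G v-isolated))

  Captured : Subset n → Subset n → Fin n → Set
  Captured A B x = x ∈ B × Exposed A B x

  captured⇒¬AliceWins : ∀ {A B x} → Captured A B x → ¬ AliceWins G A B
  captured⇒¬AliceWins (x∈B , exposed) (win v (_ , v∉B) dom) =
    undominated⇒¬Dominates (proj₂ (exposed-∪ˡ v∉B (λ { refl → v∉B x∈B }) exposed)) dom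
  captured⇒¬AliceWins (x∈B , exposed) (play v (_ , v∉B) _ (u , u-free) respond) =
    captured⇒¬AliceWins (x∈p⇒x∈⁅y⁆∪p x∈B , exposed-∪ʳ (exposed-∪ˡ v∉B (λ { refl → v∉B x∈B }) exposed))
                        (proj₂ (respond u u-free))

  -- Otherwise Bob claims x next and x is captured.
  forcedMove : ∀ {A B x} → x ∉ B → Exposed A B x → AliceWins G A B → AliceWinsAfterMove (⁅ x ⁆ ∪ A) B
  forcedMove {A} {B} {x} x∉B exposed aliceWins with aliceMove aliceWins
  ... | v , (_ , v∉B) , after with x ≟ v
  ...   | yes refl = after
  ...   | no x≢v   = ⊥-elim (aliceLoses after)
    where
    exposed′ : Exposed (⁅ v ⁆ ∪ A) B x
    exposed′ = exposed-∪ˡ v∉B x≢v exposed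

    aliceLoses : ¬ AliceWinsAfterMove (⁅ v ⁆ ∪ A) B
    aliceLoses (inj₁ dom)       = undominated⇒¬Dominates (proj₂ exposed′) dom
    aliceLoses (inj₂ bobToMove) =
      captured⇒¬AliceWins (x∈⁅x⁆∪p , exposed-∪ʳ exposed′) (bobToMove x (proj₁ (proj₂ exposed′) , x∉B))

  -- X is the part of the forest still to be matched; Alice has touched neither X nor its boundary.
  Sealed : Subset n → Subset n → Subset n → Set
  Sealed A B X = (∀ {x} → x ∈ X → Unclaimed A B x) ×
                 (∀ {x y} → x ∈ X → Adj G x y → y ∈ X ⊎ (y ∈ B × y ∉ A))

  sealed⇒undominated : ∀ {A B X x} → Sealed A B X → x ∈ X → Undominated A x
  sealed⇒undominated {A} {x = x} (free , leaving) x∈X = proj₁ (free x∈X) , nbr∉A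
    where
    nbr∉A : ∀ {y} → Adj G y x → y ∉ A
    nbr∉A y~x with leaving x∈X (Adj-sym G y~x)
    ... | inj₁ y∈X       = proj₁ (free y∈X)
    ... | inj₂ (_ , y∉A) = y∉A

  sealed∧isolated⇒captured : ∀ {A B X x} → Sealed A B X → x ∈ X → (∀ {y} → y ∈ X → ¬ Adj G x y) →
                             Captured A (⁅ x ⁆ ∪ B) x
  sealed∧isolated⇒captured {B = B} {x = x} sealed@(_ , leaving) x∈X isolated =
    x∈⁅x⁆∪p , exposed-∪ʳ (nbr∈B , sealed⇒undominated sealed x∈X)
    where
    nbr∈B : ∀ {y} → Adj G y x → y ∈ B
    nbr∈B y~x with leaving x∈X (Adj-sym G y~x)
    ... | inj₁ y∈X       = contradiction (Adj-sym G y~x) (isolated y∈X)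
    ... | inj₂ (y∈B , _) = y∈B

  sealed∧leaf⇒exposed : ∀ {A B X ℓ s} → Sealed A B X → ℓ ∈ X → s ∈ X → Adj G ℓ s →
                        AtMostOneNeighbourIn G X ℓ → Exposed A (⁅ s ⁆ ∪ B) ℓ
  sealed∧leaf⇒exposed {B = B} {ℓ = ℓ} {s} sealed@(_ , leaving) ℓ∈X s∈X ℓ~s atMostOne =
    nbr∈⁅s⁆∪B , sealed⇒undominated sealed ℓ∈X
    where
    nbr∈⁅s⁆∪B : ∀ {y} → Adj G y ℓ → y ∈ ⁅ s ⁆ ∪ B
    nbr∈⁅s⁆∪B y~ℓ with leaving ℓ∈X (Adj-sym G y~ℓ)
    ... | inj₁ y∈X       = subst (_∈ ⁅ s ⁆ ∪ B) (atMostOne s∈X y∈X ℓ~s (Adj-sym G y~ℓ)) x∈⁅x⁆∪p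
    ... | inj₂ (y∈B , _) = x∈p⇒x∈⁅y⁆∪p y∈B

  sealed-removeLeaf : ∀ {A B X ℓ s} → Sealed A B X → ℓ ∈ X → s ∈ X → Adj G ℓ s →
                      AtMostOneNeighbourIn G X ℓ → Sealed (⁅ ℓ ⁆ ∪ A) (⁅ s ⁆ ∪ B) (X - ℓ - s)
  sealed-removeLeaf {A} {B} {X} {ℓ} {s} (free , leaving) ℓ∈X s∈X ℓ~s atMostOne = free′ , leaving′
    where
    free′ : ∀ {x} → x ∈ X - ℓ - s → Unclaimed (⁅ ℓ ⁆ ∪ A) (⁅ s ⁆ ∪ B) x
    free′ x∈ = let x∈X , x≢ℓ , x≢s = x∈p-y-z⁻ x∈ ; x∉A , x∉B = free x∈X
               in  x≢y∧x∉p⇒x∉⁅y⁆∪p x≢ℓ x∉A , x≢y∧x∉p⇒x∉⁅y⁆∪p x≢s x∉B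

    leaving′ : ∀ {x y} → x ∈ X - ℓ - s → Adj G x y →
               y ∈ X - ℓ - s ⊎ (y ∈ ⁅ s ⁆ ∪ B × y ∉ ⁅ ℓ ⁆ ∪ A)
    leaving′ {x} {y} x∈ x~y with x∈p-y-z⁻ x∈ | leaving (proj₁ (x∈p-y-z⁻ x∈)) x~y
    ... | _ , _ , _ | inj₂ (y∈B , y∉A) =
      inj₂ (x∈p⇒x∈⁅y⁆∪p y∈B , x≢y∧x∉p⇒x∉⁅y⁆∪p (λ { refl → proj₂ (free ℓ∈X) y∈B }) y∉A)
    ... | x∈X , _ , x≢s | inj₁ y∈X with y ≟ ℓ | y ≟ s
    ...   | yes refl | _        = contradiction (atMostOne x∈X s∈X (Adj-sym G x~y) ℓ~s) x≢s
    ...   | no y≢ℓ   | yes refl = inj₂ (x∈⁅x⁆∪p , x≢y∧x∉p⇒x∉⁅y⁆∪p y≢ℓ (proj₁ (free s∈X)))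
    ...   | no y≢ℓ   | no y≢s   = inj₁ (x∈p-y-z⁺ y∈X y≢ℓ y≢s)

  winningPosition⇒perfectMatching : Forest G → ∀ {A B X} → Acc _⊂_ X → Sealed A B X →
                                     AliceWinsAfterMove A B → PerfectMatching G X
  winningPosition⇒perfectMatching forest {A} {B} {X} (acc smaller) sealed after with nonempty? X
  ... | no X-empty = emptyPerfectMatching X-empty
  ... | yes (x₀ , x₀∈X) with after
  ...   | inj₁ dom = contradiction dom (undominated⇒¬Dominates (sealed⇒undominated sealed x₀∈X))
  ...   | inj₂ bobToMove with forest⇒atMostOneNeighbourIn G forest x₀∈X
  ...     | ℓ , ℓ∈X , atMostOne with any? (λ s → s ∈? X ×-dec adj G ℓ s Bool.≟ true)
  ...       | no ∄s = contradiction (bobToMove ℓ (proj₁ sealed ℓ∈X))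
                                    (captured⇒¬AliceWins (sealed∧isolated⇒captured sealed ℓ∈X isolated))
    where
    isolated : ∀ {y} → y ∈ X → ¬ Adj G ℓ y
    isolated y∈X ℓ~y = ∄s (_ , y∈X , ℓ~y)
  ...       | yes (s , s∈X , ℓ~s) =
    addEdge ℓ∈X s∈X ℓ~s (winningPosition⇒perfectMatching forest (smaller X-ℓ-s⊂X) sealed′ after′)
    where
    X-ℓ-s⊂X : X - ℓ - s ⊂ X
    X-ℓ-s⊂X = ⊆-⊂-trans (p─q⊆p (X - ℓ) ⁅ s ⁆) (x∈p⇒p-x⊂p ℓ∈X)

    sealed′ : Sealed (⁅ ℓ ⁆ ∪ A) (⁅ s ⁆ ∪ B) (X - ℓ - s)
    sealed′ = sealed-removeLeaf sealed ℓ∈X s∈X ℓ~s atMostOne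

    ℓ∉⁅s⁆∪B : ℓ ∉ ⁅ s ⁆ ∪ B
    ℓ∉⁅s⁆∪B = x≢y∧x∉p⇒x∉⁅y⁆∪p (λ { refl → Adj-irrefl G ℓ~s }) (proj₂ (proj₁ sealed ℓ∈X))

    after′ : AliceWinsAfterMove (⁅ ℓ ⁆ ∪ A) (⁅ s ⁆ ∪ B)
    after′ = forcedMove ℓ∉⁅s⁆∪B (sealed∧leaf⇒exposed sealed ℓ∈X s∈X ℓ~s atMostOne)
                        (bobToMove s (proj₁ sealed s∈X))

  dominates? : U.Decidable (Dominates G)
  dominates? D = all? (λ v → v ∈? D ⊎-dec any? (λ u → u ∈? D ×-dec adj G u v Bool.≟ true))

module PairingStrategy {G : Graph n} {v₀ : Fin n} (v₀-isolated : Isolated G v₀)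
                       (P : PerfectMatching G (⊤ - v₀)) where
  open PerfectMatching P

  mate≢v₀ : ∀ {x} → x ≢ v₀ → mate x ≢ v₀
  mate≢v₀ x≢v₀ = x∈⊤-y⇒x≢y (mate-∈ (x≢y⇒x∈⊤-y x≢v₀))

  mate-injective : ∀ {x y} → x ≢ v₀ → y ≢ v₀ → mate x ≡ mate y → x ≡ y
  mate-injective {x} {y} x≢v₀ y≢v₀ mx≡my = begin
    x             ≡⟨ mate-invol (x≢y⇒x∈⊤-y x≢v₀) ⟨
    mate (mate x) ≡⟨ cong mate mx≡my ⟩
    mate (mate y) ≡⟨ mate-invol (x≢y⇒x∈⊤-y y≢v₀) ⟩
    y             ∎
    where open ≡.≡-Reasoning

  -- Invariant of the pairing strategy, in which Alice answers each claim of Bob by its mate.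
  Paired : Subset n → Subset n → Set
  Paired A B = v₀ ∈ A × v₀ ∉ B × (∀ {x} → x ∈ B → mate x ∈ A) ×
               (∀ {x} → Unclaimed A B x → Unclaimed A B (mate x))

  paired∧¬Dominates⇒unclaimed : ∀ {A B} → Paired A B → ¬ Dominates G A → ∃ (Unclaimed A B)
  paired∧¬Dominates⇒unclaimed {A} {B} (v₀∈A , v₀∉B , mate∈A , _) ¬dom
    with any? (λ x → ¬? (x ∈? A) ×-dec ¬? (x ∈? B))
  ... | yes found = found
  ... | no ∄x     = contradiction dominates ¬dom
    where
    dominates : Dominates G A
    dominates x with x ∈? A | x ∈? B
    ... | yes x∈A | _       = inj₁ x∈A
    ... | no _    | yes x∈B =
      inj₂ (mate x , mate∈A x∈B , Adj-sym G (mate-adj (x≢y⇒x∈⊤-y λ { refl → v₀∉B x∈B })))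
    ... | no x∉A  | no x∉B  = contradiction (x , x∉A , x∉B) ∄x

  paired∧unclaimed⇒¬Dominates : ∀ {A B u} → Paired A B → Unclaimed A B u → ¬ Dominates G (⁅ u ⁆ ∪ B)
  paired∧unclaimed⇒¬Dominates (v₀∈A , v₀∉B , _) (u∉A , _) =
    Isolated∉⇒¬Dominates G v₀-isolated (x≢y∧x∉p⇒x∉⁅y⁆∪p (λ { refl → u∉A v₀∈A }) v₀∉B)

  paired-step : ∀ {A B u} → Paired A B → Unclaimed A B u →
                Unclaimed A (⁅ u ⁆ ∪ B) (mate u) × Paired (⁅ mate u ⁆ ∪ A) (⁅ u ⁆ ∪ B)
  paired-step {A} {B} {u} (v₀∈A , v₀∉B , mate∈A , mate-free) u-free@(u∉A , _) =
    (m∉A , x≢y∧x∉p⇒x∉⁅y⁆∪p m≢u m∉B) ,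
    x∈p⇒x∈⁅y⁆∪p v₀∈A , x≢y∧x∉p⇒x∉⁅y⁆∪p (≢-sym u≢v₀) v₀∉B , mate∈A′ , mate-free′
    where
    m : Fin n
    m = mate u

    u≢v₀ : u ≢ v₀
    u≢v₀ refl = u∉A v₀∈A

    m∉A : m ∉ A
    m∉A = proj₁ (mate-free u-free)

    m∉B : m ∉ B
    m∉B = proj₂ (mate-free u-free)

    m≢u : m ≢ u
    m≢u m≡u = Adj-irrefl G (subst (Adj G u) m≡u (mate-adj (x≢y⇒x∈⊤-y u≢v₀)))

    mate∈A′ : ∀ {x} → x ∈ ⁅ u ⁆ ∪ B → mate x ∈ ⁅ m ⁆ ∪ A
    mate∈A′ x∈ with x∈⁅y⁆∪p⁻ x∈
    ... | inj₁ refl = x∈⁅x⁆∪p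
    ... | inj₂ x∈B  = x∈p⇒x∈⁅y⁆∪p (mate∈A x∈B)

    mate-free′ : ∀ {x} → Unclaimed (⁅ m ⁆ ∪ A) (⁅ u ⁆ ∪ B) x →
                 Unclaimed (⁅ m ⁆ ∪ A) (⁅ u ⁆ ∪ B) (mate x)
    mate-free′ {x} (x∉A′ , x∉B′) with x∉⁅y⁆∪p⁻ x∉A′ | x∉⁅y⁆∪p⁻ x∉B′
    ... | x≢m , x∉A | x≢u , x∉B =
      let mx∉A , mx∉B = mate-free (x∉A , x∉B)
      in  x≢y∧x∉p⇒x∉⁅y⁆∪p (x≢u ∘ mate-injective x≢v₀ u≢v₀) mx∉A , x≢y∧x∉p⇒x∉⁅y⁆∪p mx≢u mx∉B
      where
      x≢v₀ : x ≢ v₀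
      x≢v₀ refl = x∉A v₀∈A

      mx≢u : mate x ≢ u
      mx≢u refl = x≢m (≡.sym (mate-invol (x≢y⇒x∈⊤-y x≢v₀)))

  pairing : ∀ {A B v} → Acc _⊃_ B → Unclaimed A B v → Paired (⁅ v ⁆ ∪ A) B → AliceWins G A B
  pairing {A} {B} {v} (acc larger) v-free paired with dominates? G (⁅ v ⁆ ∪ A)
  ... | yes dom = win v v-free dom
  ... | no ¬dom = play v v-free ¬dom (paired∧¬Dominates⇒unclaimed paired ¬dom) respond
    where
    respond : ∀ u → Unclaimed (⁅ v ⁆ ∪ A) B u →
              ¬ Dominates G (⁅ u ⁆ ∪ B) × AliceWins G (⁅ v ⁆ ∪ A) (⁅ u ⁆ ∪ B)
    respond u u-free = let mate-free , paired′ = paired-step paired u-free in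
      paired∧unclaimed⇒¬Dominates paired u-free ,
      pairing (larger (x∉p⇒p⊂⁅x⁆∪p (proj₂ u-free))) mate-free paired′

  aliceWins : OutcomeA G
  aliceWins = pairing (⊃-wellFounded _) (∉⊥ , ∉⊥) paired₀
    where
    paired₀ : Paired (⁅ v₀ ⁆ ∪ ⊥) ⊥
    paired₀ = x∈⁅x⁆∪p , ∉⊥ , (λ x∈⊥ → contradiction x∈⊥ ∉⊥) ,
              λ (x∉ , _) → x≢y∧x∉p⇒x∉⁅y⁆∪p (mate≢v₀ (proj₁ (x∉⁅y⁆∪p⁻ x∉))) ∉⊥ , ∉⊥

lemma15 : (n : ℕ) (F : Graph n) → Forest F → (v₀ : Fin n) → Isolated F v₀ →
          (OutcomeA F ⇔ PerfectMatchingMinus F v₀)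
lemma15 n F forest v₀ v₀-isolated = mk⇔ win⇒matching matching⇒win
  where
  sealed₀ : Sealed F (⁅ v₀ ⁆ ∪ ⊥) ⊥ (⊤ - v₀)
  sealed₀ = (λ x∈ → x≢y∧x∉p⇒x∉⁅y⁆∪p (x∈⊤-y⇒x≢y x∈) ∉⊥ , ∉⊥) ,
            λ _ x~y → inj₁ (x≢y⇒x∈⊤-y λ { refl → Isolated⇒¬Adj F v₀-isolated x~y })

  win⇒matching : OutcomeA F → PerfectMatchingMinus F v₀
  win⇒matching aliceWins = toPerfectMatchingMinus
    (winningPosition⇒perfectMatching F forest (⊂-wellFounded _) sealed₀
      (forcedMove F ∉⊥ (isolated⇒exposed F v₀-isolated ∉⊥) aliceWins))

  matching⇒win : PerfectMatchingMinus F v₀ → OutcomeA F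
  matching⇒win matching = PairingStrategy.aliceWins v₀-isolated (fromPerfectMatchingMinus matching)
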